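{- Let $h(d)=\mu^2(d)\prod_{p\mid d}(1-2p^{ -2})^{ -1}$ and let $\beta$ be the arithmetic function determined by $h(d)=\sum_{d_1d_2=d}\beta(d_1)$ for all $d\ge1$. Then $\beta$ is supported on cubefree integers, and there is an absolute constant $c>0$ such that for every cubefree $t$ written as $t=ab^2$ with $a,b$ squarefree and $\gcd(a,b)=1$, $|\beta(t)|\le c\, d(a)/a^2$.
   Context: $\mu$ is the Möbius function, $d(a)$ the number of divisors of $a$, products over $p$ run over primes. -}

module Defs where

open import Data.Bool using (Bool; true; false; not; _∧_; if_then_else_; T)
open import Data.Nat as ℕ using (ℕ; zero; suc; _*_; _≤_)
open import Data.Nat.Divisibility using (_∣_; _∣?_)
open import Data.Nat.Primality using (Prime; prime?)
open import Data.List using (List; []; _∷_; filter; map; upTo; foldr; length)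
open import Data.Integer using (+_)
open import Data.Rational as ℚ using (ℚ; 0ℚ; 1ℚ; _+_; _-_; _≟_; 1/_; ≢-nonZero)
open import Relation.Nullary using (yes; no)
open import Relation.Binary.PropositionalEquality using (_≡_)
open import Relation.Nullary.Decidable using (⌊_⌋)

range : ℕ → ℕ → List ℕ
range a b = map (λ i → a ℕ.+ i) (upTo (suc b ℕ.∸ a))

-- positive divisors of n (for n ≥ 1); divisors 0 = []
divisors : ℕ → List ℕ
divisors n = filter (λ k → k ∣? n) (range 1 n)

primeDivisors : ℕ → List ℕ
primeDivisors n = filter prime? (divisors n)

numDivisors : ℕ → ℕ
numDivisors n = length (divisors n)

-- n is squarefree: n ≠ 0 and no k ≥ 2 has k² ∣ n (such k would satisfy k ≤ n)
isSquareFree : ℕ → Bool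
isSquareFree zero = false
isSquareFree n@(suc _) = foldr _∧_ true (map (λ k → not ⌊ (k * k) ∣? n ⌋) (range 2 n))

SquareFree : ℕ → Set
SquareFree n = T (isSquareFree n)

isCubeFree : ℕ → Bool
isCubeFree zero = false
isCubeFree n@(suc _) = foldr _∧_ true (map (λ k → not ⌊ (k * k * k) ∣? n ⌋) (range 2 n))

CubeFree : ℕ → Set
CubeFree n = T (isCubeFree n)

μ² : ℕ → ℚ
μ² n = if isSquareFree n then 1ℚ else 0ℚ

ι : ℕ → ℚ
ι n = (+ n) ℚ./ 1

-- reciprocal (total; the value at 0 is never used below since all
-- arguments are nonzero)
recip : ℚ → ℚ
recip q with q ≟ 0ℚ
... | yes _ = 0ℚ
... | no q≢0 = 1/_ q {{≢-nonZero q≢0}}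

sumℚ : List ℚ → ℚ
sumℚ = foldr _+_ 0ℚ

prodℚ : List ℚ → ℚ
prodℚ = foldr ℚ._*_ 1ℚ

h : ℕ → ℚ
h d = μ² d ℚ.* prodℚ (map (λ p → recip (1ℚ - ι 2 ℚ.* recip (ι (p * p)))) (primeDivisors d))

-- β is determined by h(d) = Σ_{d₁ d₂ = d} β(d₁) = Σ_{d₁ ∣ d} β(d₁) for all d ≥ 1
IsBeta : (ℕ → ℚ) → Set
IsBeta β = ∀ d → 1 ≤ d → h d ≡ sumℚ (map β (divisors d))

-- β is the Dirichlet convolution of h with μ, and h is multiplicative with h(p) = r_p := (1 - 2p⁻²)⁻¹
-- and h(p^k) = 0 for k ≥ 2. Hence β(p^(k+1) m) = (h(p^(k+1)) - h(p^k)) β(m) for p ∤ m: β(p) = r_p - 1,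
-- β(p²) = -r_p and β vanishes on multiples of cubes. As (r_p - 1) p² = 2 r_p, peeling the primes off
-- t = ab² one at a time gives the exact formula |β(ab²)| a² = d(a) h(ab). Finally h(n) ≤ ∏_{p ∣ n} r_p ≤ 6:
-- since r_p (p + 1)/(p - 1) ≤ p/(p - 2), the product of r_p over distinct p ≥ L is at most L/(L - 2),
-- which is 3 for the odd primes, and r_2 = 2.

module Submission where

open import Defs

module RationalArithmetic where

  open import Data.Empty using (⊥-elim)
  open import Data.Integer as ℤ using ()
  import Data.Integer.Properties as ℤP
  open import Data.List using ([]; _∷_; _++_; map)
  open import Data.List.Membership.Propositional using (_∈_)
  open import Data.List.Relation.Unary.Any using (here; there)
  import Data.List.Relation.Unary.All as All
  open import Data.List.Relation.Unary.AllPairs using (_∷_)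
  open import Data.List.Relation.Unary.Unique.Propositional using (Unique)
  open import Data.List.Relation.Binary.Permutation.Propositional using (_↭_; ↭⇒↭ₛ)
  import Data.List.Relation.Binary.Permutation.Setoid.Properties as PermutationSetoid
  open import Data.Nat as ℕ using (suc; z≤n)
  import Data.Nat.Coprimality as Coprimality
  open import Data.Rational using (ℚ; 0ℚ; 1ℚ; _+_; _*_; _-_; _≤_; _<_; _≟_; toℚᵘ)
  import Data.Rational as ℚ
  import Data.Rational.Properties as ℚP
  open import Data.Rational.Solver using (module +-*-Solver)
  open import Data.Rational.Unnormalised as ℚᵘ using (mkℚᵘ; *≡*)
  import Data.Rational.Unnormalised.Properties as ℚᵘP
  open import Relation.Binary.PropositionalEquality
  open import Relation.Nullary using (yes; no)
  open +-*-Solver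

  ι≡mkℚ : ∀ n → ι n ≡ ℚ.mkℚ (ℤ.+ n) 0 (Coprimality.sym (Coprimality.1-coprimeTo n))
  ι≡mkℚ n = ℚP.normalize-coprime (Coprimality.sym (Coprimality.1-coprimeTo n))

  toℚᵘ-ι : ∀ n → toℚᵘ (ι n) ≡ mkℚᵘ (ℤ.+ n) 0
  toℚᵘ-ι n = cong toℚᵘ (ι≡mkℚ n)

  ι-+ : ∀ m n → ι (m ℕ.+ n) ≡ ι m + ι n
  ι-+ m n = ℚP.toℚᵘ-injective (begin
    toℚᵘ (ι (m ℕ.+ n))                  ≡⟨ toℚᵘ-ι (m ℕ.+ n) ⟩
    mkℚᵘ (ℤ.+ (m ℕ.+ n)) 0              ≈⟨ *≡* +-homo ⟩
    mkℚᵘ (ℤ.+ m) 0 ℚᵘ.+ mkℚᵘ (ℤ.+ n) 0  ≡⟨ cong₂ ℚᵘ._+_ (toℚᵘ-ι m) (toℚᵘ-ι n) ⟨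
    toℚᵘ (ι m) ℚᵘ.+ toℚᵘ (ι n)          ≈⟨ ℚP.toℚᵘ-homo-+ (ι m) (ι n) ⟨
    toℚᵘ (ι m + ι n)                    ∎)
    where
    open ℚᵘP.≃-Reasoning
    +-homo = trans (ℤP.*-identityʳ _) (trans (ℤP.pos-+ m n) (sym (trans (ℤP.*-identityʳ _)
               (cong₂ ℤ._+_ (ℤP.*-identityʳ (ℤ.+ m)) (ℤP.*-identityʳ (ℤ.+ n))))))

  ι-* : ∀ m n → ι (m ℕ.* n) ≡ ι m * ι n
  ι-* m n = ℚP.toℚᵘ-injective (begin
    toℚᵘ (ι (m ℕ.* n))                  ≡⟨ toℚᵘ-ι (m ℕ.* n) ⟩
    mkℚᵘ (ℤ.+ (m ℕ.* n)) 0              ≈⟨ *≡* (cong (ℤ._* ℤ.+ 1) (ℤP.pos-* m n)) ⟩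
    mkℚᵘ (ℤ.+ m) 0 ℚᵘ.* mkℚᵘ (ℤ.+ n) 0  ≡⟨ cong₂ ℚᵘ._*_ (toℚᵘ-ι m) (toℚᵘ-ι n) ⟨
    toℚᵘ (ι m) ℚᵘ.* toℚᵘ (ι n)          ≈⟨ ℚP.toℚᵘ-homo-* (ι m) (ι n) ⟨
    toℚᵘ (ι m * ι n)                    ∎)
    where open ℚᵘP.≃-Reasoning

  ι-mono-≤ : ∀ {m n} → m ℕ.≤ n → ι m ≤ ι n
  ι-mono-≤ {m} {n} m≤n rewrite ι≡mkℚ m | ι≡mkℚ n =
    ℚ.*≤* (subst₂ ℤ._≤_ (sym (ℤP.*-identityʳ _)) (sym (ℤP.*-identityʳ _)) (ℤ.+≤+ m≤n))

  0≤ι : ∀ n → 0ℚ ≤ ι n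
  0≤ι n = ι-mono-≤ {0} {n} z≤n

  0<ι : ∀ {n} → 1 ℕ.≤ n → 0ℚ < ι n
  0<ι {suc n} _ rewrite ι≡mkℚ (suc n) = ℚP.positive⁻¹ _

  ι≢0 : ∀ {n} → 1 ℕ.≤ n → ι n ≢ 0ℚ
  ι≢0 1≤n ι≡0 = ℚP.<-irrefl (sym ι≡0) (0<ι 1≤n)

  *-recip : ∀ q → q ≢ 0ℚ → q * recip q ≡ 1ℚ
  *-recip q q≢0 with q ≟ 0ℚ
  ... | yes q≡0 = ⊥-elim (q≢0 q≡0)
  ... | no q≢0′ = ℚP.*-inverseʳ q {{ℚ.≢-nonZero q≢0′}}

  0≤recip : ∀ {q} → 0ℚ < q → 0ℚ ≤ recip q
  0≤recip {q} 0<q with q ≟ 0ℚ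
  ... | yes _ = ℚP.≤-refl
  ... | no q≢0 = ℚP.<⇒≤ (ℚP.positive⁻¹ _ {{ℚP.1/pos⇒pos q {{ℚ.positive 0<q}}}})

  0≤⇒*-monoˡ-≤ : ∀ {r p q} → 0ℚ ≤ r → p ≤ q → r * p ≤ r * q
  0≤⇒*-monoˡ-≤ {r} 0≤r = ℚP.*-monoˡ-≤-nonNeg r {{ℚ.nonNegative 0≤r}}

  0≤⇒*-monoʳ-≤ : ∀ {r p q} → 0ℚ ≤ r → p ≤ q → p * r ≤ q * r
  0≤⇒*-monoʳ-≤ {r} 0≤r = ℚP.*-monoʳ-≤-nonNeg r {{ℚ.nonNegative 0≤r}}

  0<⇒*-cancelʳ-≤ : ∀ {r p q} → 0ℚ < r → p * r ≤ q * r → p ≤ q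
  0<⇒*-cancelʳ-≤ {r} 0<r = ℚP.*-cancelʳ-≤-pos r {{ℚ.positive 0<r}}

  0≤* : ∀ {p q} → 0ℚ ≤ p → 0ℚ ≤ q → 0ℚ ≤ p * q
  0≤* {p} 0≤p 0≤q = subst (_≤ p * _) (ℚP.*-zeroʳ p) (0≤⇒*-monoˡ-≤ 0≤p 0≤q)

  sumℚ-↭ : ∀ {xs ys} → xs ↭ ys → sumℚ xs ≡ sumℚ ys
  sumℚ-↭ xs↭ys = PermutationSetoid.foldr-commMonoid (setoid ℚ) ℚP.+-0-isCommutativeMonoid (↭⇒↭ₛ xs↭ys)

  prodℚ-↭ : ∀ {xs ys} → xs ↭ ys → prodℚ xs ≡ prodℚ ys
  prodℚ-↭ xs↭ys = PermutationSetoid.foldr-commMonoid (setoid ℚ) ℚP.*-1-isCommutativeMonoid (↭⇒↭ₛ xs↭ys)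

  sumℚ-++ : ∀ xs ys → sumℚ (xs ++ ys) ≡ sumℚ xs + sumℚ ys
  sumℚ-++ []       ys = sym (ℚP.+-identityˡ (sumℚ ys))
  sumℚ-++ (x ∷ xs) ys = trans (cong (x +_) (sumℚ-++ xs ys)) (sym (ℚP.+-assoc x (sumℚ xs) (sumℚ ys)))

  sumℚ-map-linear : ∀ {A : Set} (f g : A → ℚ) c xs →
    sumℚ (map (λ x → f x - c * g x) xs) ≡ sumℚ (map f xs) - c * sumℚ (map g xs)
  sumℚ-map-linear f g c []       = solve 1 (λ c → con 0ℚ := con 0ℚ :- c :* con 0ℚ) refl c
  sumℚ-map-linear f g c (x ∷ xs) = trans (cong (f x - c * g x +_) (sumℚ-map-linear f g c xs))
    (solve 5 (λ a b c s t → (a :- c :* b) :+ (s :- c :* t) := (a :+ s) :- c :* (b :+ t)) refl (f x) (g x) c _ _)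

  sumℚ-map-zero : ∀ {A : Set} (f : A → ℚ) {xs} → (∀ {x} → x ∈ xs → f x ≡ 0ℚ) → sumℚ (map f xs) ≡ 0ℚ
  sumℚ-map-zero f {[]}     _     = refl
  sumℚ-map-zero f {x ∷ xs} zeros =
    trans (cong₂ _+_ (zeros (here refl)) (sumℚ-map-zero f (λ x∈ → zeros (there x∈)))) (ℚP.+-identityʳ 0ℚ)

  sumℚ-map-single : ∀ {A : Set} (f : A → ℚ) {xs x} → Unique xs → x ∈ xs →
    (∀ {y} → y ∈ xs → y ≢ x → f y ≡ 0ℚ) → sumℚ (map f xs) ≡ f x
  sumℚ-map-single f {x ∷ xs} (x≢xs ∷ _) (here refl) others =
    trans (cong (f x +_) (sumℚ-map-zero f (λ y∈ → others (there y∈) (λ { refl → All.lookup x≢xs y∈ refl }))))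
          (ℚP.+-identityʳ (f x))
  sumℚ-map-single f {y ∷ xs} (y≢xs ∷ xs!) (there x∈) others =
    trans (cong (_+ sumℚ (map f xs)) (others (here refl) (λ { refl → All.lookup y≢xs x∈ refl })))
          (trans (ℚP.+-identityˡ _) (sumℚ-map-single f xs! x∈ (λ y∈ → others (there y∈))))

module Divisors where

  open import Data.Bool using (T; not; true; _∧_)
  open import Data.Empty using (⊥-elim)
  open import Data.List using (List; []; _∷_; _++_; map; length; foldr)
  open import Data.List.Membership.Propositional using (_∈_)
  open import Data.List.Membership.Propositional.Properties
    using (∈-map⁺; ∈-map⁻; ∈-upTo⁺; ∈-filter⁺; ∈-filter⁻; ∈-++⁺ˡ; ∈-++⁺ʳ; ∈-++⁻; ∈-∃++)
  open import Data.List.Properties using (length-++; length-map)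
  open import Data.List.Relation.Unary.All as All using (All)
  import Data.List.Relation.Unary.All.Properties as All
  open import Data.List.Relation.Unary.AllPairs as AllPairs using (AllPairs; _∷_)
  import Data.List.Relation.Unary.AllPairs.Properties as AllPairs
  open import Data.List.Relation.Unary.Any using (here; there)
  open import Data.List.Relation.Unary.Unique.Propositional using (Unique)
  import Data.List.Relation.Unary.Unique.Propositional.Properties as Unique
  open import Data.List.Relation.Binary.Permutation.Propositional using (_↭_; ↭-refl; ↭-prep; ↭-trans; ↭-sym; ↭⇒↭ₛ)
  open import Data.List.Relation.Binary.Permutation.Propositional.Properties using (shift; ∈-resp-↭; ↭-length)
  import Data.List.Relation.Binary.Permutation.Setoid.Properties as PermutationSetoid
  open import Data.Nat as ℕ using (ℕ; zero; suc; _+_; _*_; _^_; _≤_; _<_; z≤n; s≤s)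
  open import Data.Nat.Properties
  open import Data.Nat.Divisibility
  open import Data.Nat.Coprimality using (Coprime; coprime-divisor)
  import Data.Nat.Coprimality as Coprimality
  open import Data.Nat.Induction using (<-wellFounded)
  open import Data.Nat.ListAction using (product)
  open import Data.Nat.Primality using (Prime; prime?; prime⇒nonZero; prime⇒nonTrivial; prime⇒irreducible; euclidsLemma)
  open import Data.Nat.Primality.Factorisation using (factorise)
  open import Data.Nat.Tactic.RingSolver using (solve-∀)
  open import Data.Product using (∃-syntax; _×_; _,_; proj₁; proj₂)
  open import Data.Sum using (_⊎_; inj₁; inj₂)
  open import Function using (id; _∘_)
  open import Induction.WellFounded using (Acc; acc)
  open import Relation.Binary.PropositionalEquality
  open import Relation.Nullary using (yes; no; ¬_)
  open import Relation.Nullary.Decidable using (⌊_⌋; toWitnessFalse; fromWitnessFalse)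

  unique-↭ : ∀ {A : Set} {xs ys : List A} → Unique xs → Unique ys →
    (∀ {z} → z ∈ xs → z ∈ ys) → (∀ {z} → z ∈ ys → z ∈ xs) → xs ↭ ys
  unique-↭ {xs = []}     {[]}    _ _ _ _ = ↭-refl
  unique-↭ {xs = []}     {_ ∷ _} _ _ _ ys⊆xs with () ← ys⊆xs (here refl)
  unique-↭ {xs = x ∷ xs} (x∉xs ∷ xs!) ys! xs⊆ys ys⊆xs
    with as , bs , refl ← ∈-∃++ (xs⊆ys (here refl)) = ↭-trans (↭-prep x xs↭as++bs) (↭-sym moved)
    where
    moved = shift x as bs
    x∷as++bs! = PermutationSetoid.Unique-resp-↭ (setoid _) (↭⇒↭ₛ moved) ys!
    xs⊆as++bs : ∀ {z} → z ∈ xs → z ∈ as ++ bs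
    xs⊆as++bs z∈xs with ∈-resp-↭ moved (xs⊆ys (there z∈xs))
    ... | here refl = ⊥-elim (All.lookup x∉xs z∈xs refl)
    ... | there z∈  = z∈
    as++bs⊆xs : ∀ {z} → z ∈ as ++ bs → z ∈ xs
    as++bs⊆xs z∈ with ys⊆xs (∈-resp-↭ (↭-sym moved) (there z∈))
    ... | here refl  = ⊥-elim (All.lookup (AllPairs.head x∷as++bs!) z∈ refl)
    ... | there z∈xs = z∈xs
    xs↭as++bs = unique-↭ xs! (AllPairs.tail x∷as++bs!) xs⊆as++bs as++bs⊆xs

  ∈-range⁺ : ∀ {a b x} → a ≤ x → x ≤ b → x ∈ range a b
  ∈-range⁺ {a} {b} a≤x x≤b =
    subst (_∈ range a b) (m+[n∸m]≡n a≤x) (∈-map⁺ (a +_) (∈-upTo⁺ (∸-monoˡ-< (s≤s x≤b) a≤x)))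

  ∈-range⁻ : ∀ {a b x} → x ∈ range a b → a ≤ x
  ∈-range⁻ {a} x∈ with i , _ , refl ← ∈-map⁻ (a +_) x∈ = m≤m+n a i

  range-increasing : ∀ a b → AllPairs _<_ (range a b)
  range-increasing a b = AllPairs.map⁺ (AllPairs.applyUpTo⁺₁ id _ (λ i<j _ → +-monoʳ-< a i<j))

  ∣⇒1≤ : ∀ {d n} → 1 ≤ n → d ∣ n → 1 ≤ d
  ∣⇒1≤ {zero}  1≤n 0∣n = ⊥-elim (<⇒≢ 1≤n (sym (0∣⇒≡0 0∣n)))
  ∣⇒1≤ {suc d} _   _   = s≤s z≤n

  ∣⇒∃≡* : ∀ {d n} → d ∣ n → ∃[ q ] n ≡ d * q
  ∣⇒∃≡* d∣n = quotient d∣n , m∣n⇒n≡m*quotient d∣n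

  ∈-divisors⁺ : ∀ {d n} → 1 ≤ n → d ∣ n → d ∈ divisors n
  ∈-divisors⁺ {n = n} 1≤n d∣n =
    ∈-filter⁺ (_∣? n) (∈-range⁺ (∣⇒1≤ 1≤n d∣n) (∣⇒≤ {{ℕ.>-nonZero 1≤n}} d∣n)) d∣n

  ∈-divisors⁻ : ∀ {d n} → d ∈ divisors n → d ∣ n
  ∈-divisors⁻ {n = n} d∈ = proj₂ (∈-filter⁻ (_∣? n) {xs = range 1 n} d∈)

  divisors-increasing : ∀ n → AllPairs _<_ (divisors n)
  divisors-increasing n = AllPairs.filter⁺ (_∣? n) (range-increasing 1 n)

  divisors-unique : ∀ n → Unique (divisors n)
  divisors-unique n = AllPairs.map <⇒≢ (divisors-increasing n)

  prime⇒2≤ : ∀ {p} → Prime p → 2 ≤ p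
  prime⇒2≤ {p} pp = ℕ.nonTrivial⇒n>1 p {{prime⇒nonTrivial pp}}

  m<p*m : ∀ {p m} → Prime p → 1 ≤ m → m < p * m
  m<p*m {p} {m} pp 1≤m = subst (m <_) (*-comm m p) (m<m*n m p {{ℕ.>-nonZero 1≤m}} (prime⇒2≤ pp))

  prime∤⇒coprime : ∀ {p n} → Prime p → p ∤ n → Coprime p n
  prime∤⇒coprime pp p∤n (i∣p , i∣n) with prime⇒irreducible pp i∣p
  ... | inj₁ i≡1 = i≡1
  ... | inj₂ refl = ⊥-elim (p∤n i∣n)

  ∤∧∤⇒∤* : ∀ {p m n} → Prime p → p ∤ m → p ∤ n → p ∤ m * n
  ∤∧∤⇒∤* {m = m} {n} pp p∤m p∤n p∣mn with euclidsLemma m n pp p∣mn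
  ... | inj₁ p∣m = p∤m p∣m
  ... | inj₂ p∣n = p∤n p∣n

  coprime-∣ : ∀ {d e m n} → d ∣ m → e ∣ n → Coprime m n → Coprime d e
  coprime-∣ d∣m e∣n cop (i∣d , i∣e) = cop (∣-trans i∣d d∣m , ∣-trans i∣e e∣n)

  coprime∧prime∣⇒∤ : ∀ {p m n} → Coprime m n → Prime p → p ∣ m → p ∤ n
  coprime∧prime∣⇒∤ cop pp p∣m p∣n = <⇒≢ (prime⇒2≤ pp) (sym (cop (p∣m , p∣n)))

  ∃prime∣ : ∀ {n} → 2 ≤ n → ∃[ p ] Prime p × p ∣ n
  ∃prime∣ {n} (s≤s (s≤s _)) with factorise n
  ... | record { factors = [] ; isFactorisation = () }
  ... | record { factors = p ∷ ps ; isFactorisation = n≡p*ps ; factorsPrime = pp All.∷ _ } =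
    p , pp , divides (product ps) (trans n≡p*ps (*-comm p (product ps)))

  valuation : ∀ {p n} → Prime p → 1 ≤ n → ∃[ j ] ∃[ m ] n ≡ p ^ j * m × p ∤ m
  valuation {p} {n} pp 1≤n = go n 1≤n (<-wellFounded n)
    where
    go : ∀ n → 1 ≤ n → Acc _<_ n → ∃[ j ] ∃[ m ] n ≡ p ^ j * m × p ∤ m
    go n 1≤n (acc rec) with p ∣? n
    ... | no p∤n = 0 , n , sym (*-identityˡ n) , p∤n
    ... | yes (divides q@(suc _) refl)
      with j , m , q≡pʲm , p∤m ← go q (s≤s z≤n) (rec (m<m*n q p (prime⇒2≤ pp))) =
      suc j , m , trans (cong (_* p) q≡pʲm) (trans (*-comm (p ^ j * m) p) (sym (*-assoc p (p ^ j) m))) , p∤m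
    ... | yes (divides zero refl) with () ← 1≤n

  ^∣^*⇒≤ : ∀ {p m} → Prime p → p ∤ m → ∀ i j → p ^ i ∣ p ^ j * m → i ≤ j
  ^∣^*⇒≤ pp p∤m zero    j       _ = z≤n
  ^∣^*⇒≤ {p} {m} pp p∤m (suc i) zero d =
    ⊥-elim (p∤m (∣-trans (m∣m*n (p ^ i)) (subst (p ^ suc i ∣_) (*-identityˡ m) d)))
  ^∣^*⇒≤ {p} {m} pp p∤m (suc i) (suc j) d =
    s≤s (^∣^*⇒≤ pp p∤m i j (*-cancelˡ-∣ p {{prime⇒nonZero pp}} (subst (p ^ suc i ∣_) (*-assoc p (p ^ j) m) d)))

  ∈-primeDivisors⁺ : ∀ {p n} → 1 ≤ n → Prime p → p ∣ n → p ∈ primeDivisors n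
  ∈-primeDivisors⁺ 1≤n pp p∣n = ∈-filter⁺ prime? (∈-divisors⁺ 1≤n p∣n) pp

  ∈-primeDivisors⁻ : ∀ {p n} → p ∈ primeDivisors n → Prime p × p ∣ n
  ∈-primeDivisors⁻ {n = n} p∈ with p∈divisors , pp ← ∈-filter⁻ prime? {xs = divisors n} p∈ =
    pp , ∈-divisors⁻ p∈divisors

  primeDivisors-increasing : ∀ n → AllPairs _<_ (primeDivisors n)
  primeDivisors-increasing n = AllPairs.filter⁺ prime? (divisors-increasing n)

  primeDivisors-2≤ : ∀ n → All (2 ≤_) (primeDivisors n)
  primeDivisors-2≤ n = All.tabulate (λ p∈ → prime⇒2≤ (proj₁ (∈-primeDivisors⁻ {n = n} p∈)))

  -- isSquareFree and isCubeFree unfold to this conjunction on positive arguments.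
  T-all-∤ : ∀ (f : ℕ → ℕ) {n} → (∀ {k} → 2 ≤ k → f k ∤ suc n) →
    T (foldr _∧_ true (map (λ k → not ⌊ f k ∣? suc n ⌋) (range 2 (suc n))))
  T-all-∤ f {n} ∤ =
    All.all⁻ (λ k → not ⌊ f k ∣? suc n ⌋) (All.tabulate (λ k∈ → fromWitnessFalse (∤ (∈-range⁻ {2} {suc n} k∈))))

  squareFree⇐ : ∀ {n} → 1 ≤ n → (∀ {k} → 2 ≤ k → k * k ∤ n) → SquareFree n
  squareFree⇐ {suc n} _ = T-all-∤ (λ k → k * k)

  cubeFree⇐ : ∀ {n} → 1 ≤ n → (∀ {k} → 2 ≤ k → k * k * k ∤ n) → CubeFree n
  cubeFree⇐ {suc n} _ = T-all-∤ (λ k → k * k * k)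

  squareFree⇒ : ∀ {n k} → SquareFree n → 2 ≤ k → k * k ∤ n
  squareFree⇒ {suc n} {k} sf 2≤k@(s≤s (s≤s _)) k²∣n = toWitnessFalse (All.lookup k²∤ k∈) k²∣n
    where
    k²∤ = All.all⁺ (λ k → not ⌊ k * k ∣? suc n ⌋) (range 2 (suc n)) sf
    k∈ = ∈-range⁺ 2≤k (≤-trans (m≤m*n k k) (∣⇒≤ k²∣n))

  squareFree⇒1≤ : ∀ {n} → SquareFree n → 1 ≤ n
  squareFree⇒1≤ {suc n} _ = s≤s z≤n

  squareFree-∣ : ∀ {d n} → SquareFree n → d ∣ n → SquareFree d
  squareFree-∣ sf d∣n =
    squareFree⇐ (∣⇒1≤ (squareFree⇒1≤ sf) d∣n) (λ 2≤k k²∣d → squareFree⇒ sf 2≤k (∣-trans k²∣d d∣n))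

  squareFree-p* : ∀ {p m} → Prime p → p ∤ m → SquareFree m → SquareFree (p * m)
  squareFree-p* {p} {m} pp p∤m sf =
    squareFree⇐ (*-mono-≤ (≤-trans (s≤s z≤n) (prime⇒2≤ pp)) (squareFree⇒1≤ sf)) k²∤pm
    where
    k²∤pm : ∀ {k} → 2 ≤ k → k * k ∤ p * m
    k²∤pm {k} 2≤k k²∣pm with p ∣? k
    ... | no p∤k = squareFree⇒ sf 2≤k
                     (coprime-divisor (Coprimality.sym (prime∤⇒coprime pp (∤∧∤⇒∤* pp p∤k p∤k))) k²∣pm)
    ... | yes (divides q refl) = p∤m (∣-trans (n∣m*n (q * q))
                                   (*-cancelˡ-∣ p {{prime⇒nonZero pp}} (subst (_∣ p * m) (reorder q p) k²∣pm)))
      where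
      reorder : ∀ q p → q * p * (q * p) ≡ p * (q * q * p)
      reorder = solve-∀

  ∣p*⇒ : ∀ {p e n} → Prime p → e ∣ p * n → e ∣ n ⊎ ∃[ d ] e ≡ p * d × d ∣ n
  ∣p*⇒ {p} {e} {n} pp e∣pn with p ∣? e
  ... | yes (divides d refl) =
    inj₂ (d , *-comm d p , *-cancelˡ-∣ p {{prime⇒nonZero pp}} (subst (_∣ p * n) (*-comm d p) e∣pn))
  ... | no p∤e = inj₁ (coprime-divisor (Coprimality.sym (prime∤⇒coprime pp p∤e)) e∣pn)

  ∣p^[1+k]*⇒ : ∀ {p m} → Prime p → ∀ k {e} → e ∣ p ^ suc k * m →
    e ∣ p ^ k * m ⊎ ∃[ d ] e ≡ p ^ suc k * d × d ∣ m
  ∣p^[1+k]*⇒ {p} {m} pp k {e} e∣ with ∣p*⇒ pp (subst (e ∣_) (*-assoc p (p ^ k) m) e∣)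
  ... | inj₁ e∣pᵏm = inj₁ e∣pᵏm
  ∣p^[1+k]*⇒ {p} {m} pp zero e∣ | inj₂ (d , refl , d∣1*m) =
    inj₂ (d , cong (_* d) (sym (*-identityʳ p)) , subst (d ∣_) (*-identityˡ m) d∣1*m)
  ∣p^[1+k]*⇒ {p} {m} pp (suc k) e∣ | inj₂ (d , refl , d∣) with ∣p^[1+k]*⇒ pp k d∣
  ... | inj₁ d∣pᵏm = inj₁ (subst (p * d ∣_) (sym (*-assoc p (p ^ k) m)) (*-monoʳ-∣ p d∣pᵏm))
  ... | inj₂ (d′ , refl , d′∣m) = inj₂ (d′ , sym (*-assoc p (p ^ suc k) d′) , d′∣m)

  divisors-p^[1+k]* : ∀ {p m} → Prime p → p ∤ m → 1 ≤ m → ∀ k →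
    divisors (p ^ suc k * m) ↭ divisors (p ^ k * m) ++ map (p ^ suc k *_) (divisors m)
  divisors-p^[1+k]* {p} {m} pp p∤m 1≤m k =
    unique-↭ (divisors-unique (p ^ suc k * m))
      (Unique.++⁺ (divisors-unique (p ^ k * m)) (Unique.map⁺ cancel (divisors-unique m)) disjoint) ⊆ ⊇
    where
    instance _ = prime⇒nonZero pp
    1≤pʲm : ∀ j → 1 ≤ p ^ j * m
    1≤pʲm j = *-mono-≤ (m^n>0 p j) 1≤m
    cancel : ∀ {x y} → p ^ suc k * x ≡ p ^ suc k * y → x ≡ y
    cancel = *-cancelˡ-≡ _ _ (p ^ suc k) {{m^n≢0 p (suc k)}}
    disjoint : ∀ {x} → ¬ (x ∈ divisors (p ^ k * m) × x ∈ map (p ^ suc k *_) (divisors m))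
    disjoint (x∈ , x∈′) with d , _ , refl ← ∈-map⁻ (p ^ suc k *_) x∈′ =
      <-irrefl refl (^∣^*⇒≤ pp p∤m (suc k) k (∣-trans (m∣m*n d) (∈-divisors⁻ x∈)))
    ⊆ : ∀ {e} → e ∈ divisors (p ^ suc k * m) → e ∈ divisors (p ^ k * m) ++ map (p ^ suc k *_) (divisors m)
    ⊆ e∈ with ∣p^[1+k]*⇒ pp k (∈-divisors⁻ e∈)
    ... | inj₁ e∣pᵏm = ∈-++⁺ˡ (∈-divisors⁺ (1≤pʲm k) e∣pᵏm)
    ... | inj₂ (d , refl , d∣m) = ∈-++⁺ʳ _ (∈-map⁺ (p ^ suc k *_) (∈-divisors⁺ 1≤m d∣m))
    ⊇ : ∀ {e} → e ∈ divisors (p ^ k * m) ++ map (p ^ suc k *_) (divisors m) → e ∈ divisors (p ^ suc k * m)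
    ⊇ {e} e∈ with ∈-++⁻ (divisors (p ^ k * m)) e∈
    ... | inj₁ e∈′ = ∈-divisors⁺ (1≤pʲm (suc k))
                       (subst (e ∣_) (sym (*-assoc p (p ^ k) m)) (∣n⇒∣m*n p (∈-divisors⁻ e∈′)))
    ... | inj₂ e∈′ with d , d∈ , refl ← ∈-map⁻ (p ^ suc k *_) e∈′ =
      ∈-divisors⁺ (1≤pʲm (suc k)) (*-monoʳ-∣ (p ^ suc k) (∈-divisors⁻ d∈))

  numDivisors-p* : ∀ {p m} → Prime p → p ∤ m → 1 ≤ m → numDivisors (p * m) ≡ 2 * numDivisors m
  numDivisors-p* {p} {m} pp p∤m 1≤m = begin
    length (divisors (p * m))                                    ≡⟨ cong (λ x → length (divisors (x * m))) (sym (*-identityʳ p)) ⟩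
    length (divisors (p ^ 1 * m))                                ≡⟨ ↭-length (divisors-p^[1+k]* pp p∤m 1≤m 0) ⟩
    length (divisors (1 * m) ++ map (p ^ 1 *_) (divisors m))     ≡⟨ length-++ (divisors (1 * m)) ⟩
    length (divisors (1 * m)) + length (map (p ^ 1 *_) (divisors m))
      ≡⟨ cong₂ _+_ (cong (length ∘ divisors) (*-identityˡ m)) (length-map _ (divisors m)) ⟩
    numDivisors m + numDivisors m                                ≡⟨ cong (numDivisors m +_) (sym (+-identityʳ _)) ⟩
    2 * numDivisors m                                            ∎
    where open ≡-Reasoning

  primeDivisors-p* : ∀ {p m} → Prime p → p ∤ m → 1 ≤ m → primeDivisors (p * m) ↭ p ∷ primeDivisors m
  primeDivisors-p* {p} {m} pp p∤m 1≤m =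
    unique-↭ (AllPairs.map <⇒≢ (primeDivisors-increasing (p * m)))
      (p∉ ∷ AllPairs.map <⇒≢ (primeDivisors-increasing m)) ⊆ ⊇
    where
    1≤pm = *-mono-≤ (≤-trans (s≤s z≤n) (prime⇒2≤ pp)) 1≤m
    p∉ : All (p ≢_) (primeDivisors m)
    p∉ = All.tabulate (λ { q∈ refl → p∤m (proj₂ (∈-primeDivisors⁻ {n = m} q∈)) })
    ⊆ : ∀ {q} → q ∈ primeDivisors (p * m) → q ∈ p ∷ primeDivisors m
    ⊆ q∈ with qq , q∣pm ← ∈-primeDivisors⁻ {n = p * m} q∈ with euclidsLemma p m qq q∣pm
    ... | inj₂ q∣m = there (∈-primeDivisors⁺ 1≤m qq q∣m)
    ... | inj₁ q∣p with prime⇒irreducible pp q∣p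
    ...   | inj₂ refl = here refl
    ...   | inj₁ refl with s≤s () ← prime⇒2≤ qq
    ⊇ : ∀ {q} → q ∈ p ∷ primeDivisors m → q ∈ primeDivisors (p * m)
    ⊇ (here refl) = ∈-primeDivisors⁺ 1≤pm pp (m∣m*n m)
    ⊇ (there q∈) with qq , q∣m ← ∈-primeDivisors⁻ {n = m} q∈ = ∈-primeDivisors⁺ 1≤pm qq (∣n⇒∣m*n p q∣m)

module EulerFactors where

  open RationalArithmetic
  open import Data.Nat as ℕ using (ℕ; suc; z≤n; s≤s)
  open import Data.List using ([]; _∷_; map)
  open import Data.List.Relation.Unary.All as All using (All; []; _∷_)
  open import Data.List.Relation.Unary.AllPairs using (AllPairs; []; _∷_)
  import Data.Nat.Properties as ℕP
  open import Data.Nat.Tactic.RingSolver using (solve-∀)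
  open import Data.Rational using (ℚ; 0ℚ; 1ℚ; _+_; _*_; _-_; _≤_)
  import Data.Rational as ℚ
  import Data.Rational.Properties as ℚP
  open import Data.Rational.Solver using (module +-*-Solver)
  open import Relation.Binary.PropositionalEquality
  open +-*-Solver

  -- The factor of Defs.h itself, so h n is definitionally μ² n * prodℚ (map eulerFactor (primeDivisors n)).
  eulerFactor : ℕ → ℚ
  eulerFactor p = recip (1ℚ - ι 2 * recip (ι (p ℕ.* p)))

  module _ {p : ℕ} (2≤p : 2 ℕ.≤ p) where

    private
      r = eulerFactor p
      P = ι (p ℕ.* p)
      N = p ℕ.* p ℕ.∸ 2
      4≤p*p : 4 ℕ.≤ p ℕ.* p
      4≤p*p = ℕP.*-mono-≤ 2≤p 2≤p
      2≤N : 2 ℕ.≤ N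
      2≤N = ℕP.∸-monoˡ-≤ 2 4≤p*p
      P≡N+2 : P ≡ ι N + ι 2
      P≡N+2 = trans (cong ι (sym (ℕP.m∸n+n≡m (ℕP.≤-trans (s≤s (s≤s z≤n)) 4≤p*p)))) (ι-+ N 2)

    eulerFactor-*-[p²∸2] : eulerFactor p * ι (p ℕ.* p ℕ.∸ 2) ≡ ι (p ℕ.* p)
    eulerFactor-*-[p²∸2] = begin
      r * ι N        ≡⟨ cong (r *_) (sym D*P≡N) ⟩
      r * (D * P)    ≡⟨ solve 3 (λ r D P → r :* (D :* P) := (D :* r) :* P) refl r D P ⟩
      (D * r) * P    ≡⟨ cong (_* P) (*-recip D D≢0) ⟩
      1ℚ * P         ≡⟨ ℚP.*-identityˡ P ⟩
      P              ∎
      where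
      open ≡-Reasoning
      D = 1ℚ - ι 2 * recip P
      D*P≡N : D * P ≡ ι N
      D*P≡N = begin
        D * P
          ≡⟨ solve 3 (λ t s P → (con 1ℚ :- t :* s) :* P := P :- t :* (P :* s)) refl (ι 2) (recip P) P ⟩
        P - ι 2 * (P * recip P)      ≡⟨ cong (λ x → P - ι 2 * x) (*-recip P (ι≢0 (ℕP.≤-trans (s≤s z≤n) 4≤p*p))) ⟩
        P - ι 2 * 1ℚ                 ≡⟨ cong (λ x → x - ι 2 * 1ℚ) P≡N+2 ⟩
        (ι N + ι 2) - ι 2 * 1ℚ       ≡⟨ solve 2 (λ n t → (n :+ t) :- t :* con 1ℚ := n) refl (ι N) (ι 2) ⟩
        ι N                          ∎
      D≢0 : D ≢ 0ℚ
      D≢0 D≡0 = ι≢0 (ℕP.≤-trans (s≤s z≤n) 2≤N) (trans (sym D*P≡N) (trans (cong (_* P) D≡0) (ℚP.*-zeroˡ P)))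

    1≤eulerFactor : 1ℚ ≤ eulerFactor p
    1≤eulerFactor = 0<⇒*-cancelʳ-≤ (0<ι (ℕP.≤-trans (s≤s z≤n) 2≤N))
      (subst₂ _≤_ (sym (ℚP.*-identityˡ (ι N))) (sym eulerFactor-*-[p²∸2]) (ι-mono-≤ (ℕP.m∸n≤m (p ℕ.* p) 2)))

    eulerFactor≤2 : eulerFactor p ≤ ι 2
    eulerFactor≤2 = 0<⇒*-cancelʳ-≤ (0<ι (ℕP.≤-trans (s≤s z≤n) 2≤N))
      (subst₂ _≤_ (sym eulerFactor-*-[p²∸2]) (ι-* 2 N) (ι-mono-≤ p*p≤2N))
      where
      p*p≤2N : p ℕ.* p ℕ.≤ 2 ℕ.* N
      p*p≤2N = begin
        p ℕ.* p    ≡⟨ ℕP.m∸n+n≡m (ℕP.≤-trans (s≤s (s≤s z≤n)) 4≤p*p) ⟨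
        N ℕ.+ 2    ≤⟨ ℕP.+-monoʳ-≤ N 2≤N ⟩
        N ℕ.+ N    ≡⟨ cong (N ℕ.+_) (ℕP.+-identityʳ N) ⟨
        2 ℕ.* N    ∎
        where open ℕP.≤-Reasoning

    [eulerFactor-1]*p² : (eulerFactor p - 1ℚ) * ι (p ℕ.* p) ≡ ι 2 * eulerFactor p
    [eulerFactor-1]*p² = begin
      (r - 1ℚ) * P                    ≡⟨ cong ((r - 1ℚ) *_) P≡N+2 ⟩
      (r - 1ℚ) * (ι N + ι 2)
        ≡⟨ solve 3 (λ r n t → (r :- con 1ℚ) :* (n :+ t) := (r :* n :- (n :+ t)) :+ t :* r) refl r (ι N) (ι 2) ⟩
      (r * ι N - (ι N + ι 2)) + ι 2 * r ≡⟨ cong (λ x → (r * ι N - x) + ι 2 * r) (sym P≡N+2) ⟩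
      (r * ι N - P) + ι 2 * r          ≡⟨ cong (λ x → (x - P) + ι 2 * r) eulerFactor-*-[p²∸2] ⟩
      (P - P) + ι 2 * r                ≡⟨ solve 2 (λ P x → (P :- P) :+ x := x) refl P (ι 2 * r) ⟩
      ι 2 * r                          ∎
      where open ≡-Reasoning

  0≤eulerFactor : ∀ {p} → 2 ℕ.≤ p → 0ℚ ≤ eulerFactor p
  0≤eulerFactor 2≤p = ℚP.≤-trans (ℚP.<⇒≤ (ℚP.positive⁻¹ 1ℚ)) (1≤eulerFactor 2≤p)

  0≤eulerFactor-1 : ∀ {p} → 2 ℕ.≤ p → 0ℚ ≤ eulerFactor p - 1ℚ
  0≤eulerFactor-1 2≤p = ℚP.+-monoˡ-≤ (ℚ.- 1ℚ) (1≤eulerFactor 2≤p)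

  eulerFactor-telescope : ∀ q {X} → 0ℚ ≤ X → ι (1 ℕ.+ q) * X ≤ ι (3 ℕ.+ q) →
    ι q * (eulerFactor (2 ℕ.+ q) * X) ≤ ι (2 ℕ.+ q)
  eulerFactor-telescope q {X} 0≤X bound = 0<⇒*-cancelʳ-≤ (0<ι 1≤M) (begin
    ι q * (r * X) * ι M
      ≡⟨ cong (ι q * (r * X) *_) (ι-* (1 ℕ.+ q) N) ⟩
    ι q * (r * X) * (ι (1 ℕ.+ q) * ι N)
      ≡⟨ solve 5 (λ x r X a n → x :* (r :* X) :* (a :* n) := x :* (r :* n) :* (a :* X))
               refl (ι q) r X (ι (1 ℕ.+ q)) (ι N) ⟩
    ι q * (r * ι N) * (ι (1 ℕ.+ q) * X)
      ≡⟨ cong (λ y → ι q * y * (ι (1 ℕ.+ q) * X)) (eulerFactor-*-[p²∸2] 2≤p) ⟩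
    ι q * ι (p ℕ.* p) * (ι (1 ℕ.+ q) * X)
      ≤⟨ 0≤⇒*-monoˡ-≤ (0≤* (0≤ι q) (0≤ι (p ℕ.* p))) bound ⟩
    ι q * ι (p ℕ.* p) * ι (3 ℕ.+ q)
      ≡⟨ trans (ι-* (q ℕ.* (p ℕ.* p)) (3 ℕ.+ q)) (cong (_* ι (3 ℕ.+ q)) (ι-* q (p ℕ.* p))) ⟨
    ι (q ℕ.* (p ℕ.* p) ℕ.* (3 ℕ.+ q))
      ≤⟨ ι-mono-≤ cleared ⟩
    ι (p ℕ.* M)
      ≡⟨ ι-* p M ⟩
    ι p * ι M ∎)
    where
    open ℚP.≤-Reasoning
    p = 2 ℕ.+ q
    r = eulerFactor p
    2≤p : 2 ℕ.≤ p
    2≤p = s≤s (s≤s z≤n)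
    N = p ℕ.* p ℕ.∸ 2
    N≡ : N ≡ q ℕ.* q ℕ.+ 4 ℕ.* q ℕ.+ 2
    N≡ = trans (cong (ℕ._∸ 2) (p*p≡ q)) (ℕP.m+n∸m≡n 2 _)
      where
      p*p≡ : ∀ q → (2 ℕ.+ q) ℕ.* (2 ℕ.+ q) ≡ 2 ℕ.+ (q ℕ.* q ℕ.+ 4 ℕ.* q ℕ.+ 2)
      p*p≡ = solve-∀
    M = (1 ℕ.+ q) ℕ.* N
    1≤M : 1 ℕ.≤ M
    1≤M = ℕP.*-mono-≤ {1} {1 ℕ.+ q} (s≤s z≤n) (subst (1 ℕ.≤_) (sym N≡) (ℕP.≤-trans (s≤s z≤n) (ℕP.m≤n+m 2 _)))
    cleared : q ℕ.* (p ℕ.* p) ℕ.* (3 ℕ.+ q) ℕ.≤ p ℕ.* M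
    cleared = subst (q ℕ.* (p ℕ.* p) ℕ.* (3 ℕ.+ q) ℕ.≤_)
      (sym (trans (cong (λ n → p ℕ.* ((1 ℕ.+ q) ℕ.* n)) N≡) (identity q))) (ℕP.m≤m+n _ _)
      where
      identity : ∀ q → (2 ℕ.+ q) ℕ.* ((1 ℕ.+ q) ℕ.* (q ℕ.* q ℕ.+ 4 ℕ.* q ℕ.+ 2))
                     ≡ q ℕ.* ((2 ℕ.+ q) ℕ.* (2 ℕ.+ q)) ℕ.* (3 ℕ.+ q) ℕ.+ 2 ℕ.* (2 ℕ.+ q)
      identity = solve-∀

  [2+q]/q-antitone : ∀ {l q Y} → l ℕ.≤ q → 0ℚ ≤ Y → ι q * Y ≤ ι (2 ℕ.+ q) → ι l * Y ≤ ι (2 ℕ.+ l)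
  [2+q]/q-antitone {l} {q} {Y} l≤q 0≤Y bound = 0<⇒*-cancelʳ-≤ (0<ι {2 ℕ.+ q} (s≤s z≤n)) (begin
    ι l * Y * ι (2 ℕ.+ q)              ≡⟨ solve 3 (λ a Y b → a :* Y :* b := a :* b :* Y) refl (ι l) Y (ι (2 ℕ.+ q)) ⟩
    ι l * ι (2 ℕ.+ q) * Y              ≡⟨ cong (_* Y) (ι-* l (2 ℕ.+ q)) ⟨
    ι (l ℕ.* (2 ℕ.+ q)) * Y            ≤⟨ 0≤⇒*-monoʳ-≤ 0≤Y (ι-mono-≤ cross) ⟩
    ι ((2 ℕ.+ l) ℕ.* q) * Y            ≡⟨ cong (_* Y) (ι-* (2 ℕ.+ l) q) ⟩
    ι (2 ℕ.+ l) * ι q * Y              ≡⟨ ℚP.*-assoc (ι (2 ℕ.+ l)) (ι q) Y ⟩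
    ι (2 ℕ.+ l) * (ι q * Y)            ≤⟨ 0≤⇒*-monoˡ-≤ (0≤ι (2 ℕ.+ l)) bound ⟩
    ι (2 ℕ.+ l) * ι (2 ℕ.+ q)          ∎)
    where
    open ℚP.≤-Reasoning
    expand : ∀ l q → l ℕ.* (2 ℕ.+ q) ≡ 2 ℕ.* l ℕ.+ l ℕ.* q
    expand = solve-∀
    expand′ : ∀ l q → (2 ℕ.+ l) ℕ.* q ≡ 2 ℕ.* q ℕ.+ l ℕ.* q
    expand′ = solve-∀
    cross : l ℕ.* (2 ℕ.+ q) ℕ.≤ (2 ℕ.+ l) ℕ.* q
    cross = subst₂ ℕ._≤_ (sym (expand l q)) (sym (expand′ l q)) (ℕP.+-monoˡ-≤ (l ℕ.* q) (ℕP.*-monoʳ-≤ 2 l≤q))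

  0≤prodℚ-eulerFactor : ∀ {ps} → All (2 ℕ.≤_) ps → 0ℚ ≤ prodℚ (map eulerFactor ps)
  0≤prodℚ-eulerFactor []             = ℚP.<⇒≤ (ℚP.positive⁻¹ 1ℚ)
  0≤prodℚ-eulerFactor (2≤p ∷ 2≤ps) = 0≤* (0≤eulerFactor 2≤p) (0≤prodℚ-eulerFactor 2≤ps)

  prodℚ-eulerFactor-telescope : ∀ l {ps} → AllPairs ℕ._<_ ps → All (2 ℕ.+ l ℕ.≤_) ps →
    ι l * prodℚ (map eulerFactor ps) ≤ ι (2 ℕ.+ l)
  prodℚ-eulerFactor-telescope l [] [] =
    subst (_≤ ι (2 ℕ.+ l)) (sym (ℚP.*-identityʳ (ι l))) (ι-mono-≤ {l} {2 ℕ.+ l} (ℕP.m≤n+m l 2))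
  prodℚ-eulerFactor-telescope l {suc (suc q) ∷ ps} (p<ps ∷ ps<) (s≤s (s≤s l≤q) ∷ _) =
    [2+q]/q-antitone l≤q (0≤* (0≤eulerFactor {2 ℕ.+ q} (s≤s (s≤s z≤n))) 0≤Π)
      (eulerFactor-telescope q 0≤Π (prodℚ-eulerFactor-telescope (1 ℕ.+ q) ps< p<ps))
    where
    0≤Π = 0≤prodℚ-eulerFactor (All.map (ℕP.≤-trans (s≤s (s≤s z≤n))) p<ps)

  prodℚ-eulerFactor≤6 : ∀ {ps} → AllPairs ℕ._<_ ps → All (2 ℕ.≤_) ps → prodℚ (map eulerFactor ps) ≤ ι 6
  prodℚ-eulerFactor≤6 [] [] = ι-mono-≤ {1} {6} (s≤s z≤n)
  prodℚ-eulerFactor≤6 {p ∷ ps} (p<ps ∷ ps<) (2≤p ∷ _) = begin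
    eulerFactor p * Π      ≤⟨ 0≤⇒*-monoʳ-≤ 0≤Π (eulerFactor≤2 2≤p) ⟩
    ι 2 * Π                ≤⟨ 0≤⇒*-monoˡ-≤ (0≤ι 2) Π≤3 ⟩
    ι 2 * ι 3              ∎
    where
    open ℚP.≤-Reasoning
    Π = prodℚ (map eulerFactor ps)
    3≤ps = All.map (ℕP.≤-trans (s≤s 2≤p)) p<ps
    0≤Π = 0≤prodℚ-eulerFactor (All.map (ℕP.≤-trans (s≤s (s≤s z≤n))) 3≤ps)
    Π≤3 : Π ≤ ι 3
    Π≤3 = subst (_≤ ι 3) (ℚP.*-identityˡ Π) (prodℚ-eulerFactor-telescope 1 ps< 3≤ps)

module Beta where

  open RationalArithmetic
  open Divisors
  open EulerFactors
  open import Data.Bool using (true; false; if_then_else_)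
  open import Data.Empty using (⊥-elim)
  open import Data.List using (map)
  open import Data.List.Membership.Propositional using (_∈_)
  open import Data.List.Properties using (map-++; map-∘)
  open import Data.List.Relation.Binary.Permutation.Propositional.Properties using (map⁺)
  open import Data.Nat as ℕ using (ℕ; suc; _^_; z≤n; s≤s)
  import Data.Nat.Properties as ℕP
  open import Data.Nat.Divisibility
  open import Data.Nat.Coprimality using (Coprime)
  open import Data.Nat.Induction using (<-wellFounded)
  open import Data.Nat.Primality using (Prime; prime⇒nonZero; euclidsLemma)
  open import Data.Nat.Tactic.RingSolver using (solve-∀)
  open import Data.Product using (_,_)
  open import Data.Rational using (ℚ; 0ℚ; 1ℚ; _+_; _*_; _-_; _≤_; ∣_∣)
  import Data.Rational as ℚ
  import Data.Rational.Properties as ℚP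
  open import Data.Rational.Solver using (module +-*-Solver)
  open import Data.Sum using (inj₁; inj₂)
  open import Induction.WellFounded using (Acc; acc)
  open import Relation.Binary.PropositionalEquality
  open import Relation.Nullary using (¬_; yes; no)
  open import Function using (_∘_)
  open +-*-Solver

  μ²-cong : ∀ {m n} → (SquareFree m → SquareFree n) → (SquareFree n → SquareFree m) → μ² m ≡ μ² n
  μ²-cong {m} {n} to from with isSquareFree m | isSquareFree n
  ... | true  | true  = refl
  ... | false | false = refl
  ... | true  | false = ⊥-elim (to _)
  ... | false | true  = ⊥-elim (from _)

  μ²≡0 : ∀ {n} → ¬ SquareFree n → μ² n ≡ 0ℚ
  μ²≡0 {n} ¬sf with isSquareFree n
  ... | true  = ⊥-elim (¬sf _)
  ... | false = refl

  h-p* : ∀ {p m} → Prime p → p ∤ m → 1 ℕ.≤ m → h (p ℕ.* m) ≡ eulerFactor p * h m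
  h-p* {p} {m} pp p∤m 1≤m = begin
    μ² (p ℕ.* m) * prodℚ (map eulerFactor (primeDivisors (p ℕ.* m)))
      ≡⟨ cong₂ _*_ (μ²-cong {p ℕ.* m} {m} (λ sf → squareFree-∣ sf (n∣m*n p)) (squareFree-p* pp p∤m))
                   (prodℚ-↭ (map⁺ eulerFactor (primeDivisors-p* pp p∤m 1≤m))) ⟩
    μ² m * (eulerFactor p * prodℚ (map eulerFactor (primeDivisors m)))
      ≡⟨ solve 3 (λ μ r Π → μ :* (r :* Π) := r :* (μ :* Π)) refl (μ² m) (eulerFactor p) _ ⟩
    eulerFactor p * h m ∎
    where open ≡-Reasoning

  k²∣⇒h≡0 : ∀ {k n} → 2 ℕ.≤ k → k ℕ.* k ∣ n → h n ≡ 0ℚ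
  k²∣⇒h≡0 {n = n} 2≤k k²∣n = trans (cong (_* Π) (μ²≡0 {n} (λ sf → squareFree⇒ sf 2≤k k²∣n))) (ℚP.*-zeroˡ Π)
    where Π = prodℚ (map eulerFactor (primeDivisors n))

  hLocal : ℕ → ℚ → ℚ
  hLocal 0             r = 1ℚ
  hLocal 1             r = r
  hLocal (suc (suc k)) r = 0ℚ

  h-p^k* : ∀ {p m} → Prime p → p ∤ m → 1 ℕ.≤ m → ∀ k → h (p ^ k ℕ.* m) ≡ hLocal k (eulerFactor p) * h m
  h-p^k* {p} {m} pp p∤m 1≤m 0 = trans (cong h (ℕP.*-identityˡ m)) (sym (ℚP.*-identityˡ (h m)))
  h-p^k* {p} {m} pp p∤m 1≤m 1 = trans (cong (λ x → h (x ℕ.* m)) (ℕP.*-identityʳ p)) (h-p* pp p∤m 1≤m)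
  h-p^k* {p} {m} pp p∤m 1≤m (suc (suc k)) =
    trans (k²∣⇒h≡0 (prime⇒2≤ pp) (∣m⇒∣m*n m (subst (p ℕ.* p ∣_) (ℕP.*-assoc p p (p ^ k)) (m∣m*n (p ^ k)))))
          (sym (ℚP.*-zeroˡ (h m)))

  divisorSum : (ℕ → ℚ) → ℕ → ℚ
  divisorSum f n = sumℚ (map f (divisors n))

  divisorSum-p^[1+k]* : ∀ {p m} → Prime p → p ∤ m → 1 ℕ.≤ m → ∀ k f →
    divisorSum f (p ^ suc k ℕ.* m) ≡ divisorSum f (p ^ k ℕ.* m) + divisorSum (λ d → f (p ^ suc k ℕ.* d)) m
  divisorSum-p^[1+k]* {p} {m} pp p∤m 1≤m k f = begin
    sumℚ (map f (divisors (p ^ suc k ℕ.* m)))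
      ≡⟨ sumℚ-↭ (map⁺ f (divisors-p^[1+k]* pp p∤m 1≤m k)) ⟩
    sumℚ (map f (divisors (p ^ k ℕ.* m) Data.List.++ map (p ^ suc k ℕ.*_) (divisors m)))
      ≡⟨ cong sumℚ (map-++ f (divisors (p ^ k ℕ.* m)) _) ⟩
    sumℚ (map f (divisors (p ^ k ℕ.* m)) Data.List.++ map f (map (p ^ suc k ℕ.*_) (divisors m)))
      ≡⟨ sumℚ-++ (map f (divisors (p ^ k ℕ.* m))) _ ⟩
    divisorSum f (p ^ k ℕ.* m) + sumℚ (map f (map (p ^ suc k ℕ.*_) (divisors m)))
      ≡⟨ cong (λ xs → divisorSum f (p ^ k ℕ.* m) + sumℚ xs) (sym (map-∘ (divisors m))) ⟩
    divisorSum f (p ^ k ℕ.* m) + divisorSum (λ d → f (p ^ suc k ℕ.* d)) m ∎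
    where open ≡-Reasoning

  divisorSum≡0⇒≡0 : ∀ (P : ℕ → Set) (g : ℕ → ℚ) → (∀ {d n} → d ∣ n → P n → P d) →
    (∀ n → 1 ℕ.≤ n → P n → divisorSum g n ≡ 0ℚ) → ∀ n → 1 ℕ.≤ n → P n → g n ≡ 0ℚ
  divisorSum≡0⇒≡0 P g P-∣ sums n 1≤n Pn = go n 1≤n Pn (<-wellFounded n)
    where
    go : ∀ n → 1 ℕ.≤ n → P n → Acc ℕ._<_ n → g n ≡ 0ℚ
    go n 1≤n Pn (acc rec) =
      trans (sym (sumℚ-map-single g (divisors-unique n) (∈-divisors⁺ 1≤n ∣-refl) proper)) (sums n 1≤n Pn)
      where
      proper : ∀ {d} → d ∈ divisors n → d ≢ n → g d ≡ 0ℚ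
      proper d∈ d≢n =
        go _ (∣⇒1≤ 1≤n d∣n) (P-∣ d∣n Pn) (rec (ℕP.≤∧≢⇒< (∣⇒≤ {{ℕ.>-nonZero 1≤n}} d∣n) d≢n))
        where d∣n = ∈-divisors⁻ d∈

  βLocal : ℕ → ℚ → ℚ
  βLocal k r = hLocal (suc k) r - hLocal k r

  -- Comparing the divisor sums of β over p^(k+1) n and p^k n shows that d ↦ β(p^(k+1) d) - c β(d)
  -- has vanishing divisor sums on the integers prime to p, so it vanishes.
  β-p^[1+k]* : ∀ {β} → IsBeta β → ∀ {p m} → Prime p → p ∤ m → 1 ℕ.≤ m → ∀ k →
    β (p ^ suc k ℕ.* m) ≡ βLocal k (eulerFactor p) * β m
  β-p^[1+k]* {β} isβ {p} {m} pp p∤m 1≤m k = begin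
    β (p ^ suc k ℕ.* m)  ≡⟨ solve 2 (λ x y → x := (x :- y) :+ y) refl (β (p ^ suc k ℕ.* m)) (c * β m) ⟩
    g m + c * β m        ≡⟨ cong (_+ c * β m) (divisorSum≡0⇒≡0 (p ∤_) g ∤-∣ sums m 1≤m p∤m) ⟩
    0ℚ + c * β m         ≡⟨ ℚP.+-identityˡ (c * β m) ⟩
    c * β m              ∎
    where
    open ≡-Reasoning
    c = βLocal k (eulerFactor p)
    g : ℕ → ℚ
    g d = β (p ^ suc k ℕ.* d) - c * β d
    ∤-∣ : ∀ {d n} → d ∣ n → p ∤ n → p ∤ d
    ∤-∣ d∣n p∤n p∣d = p∤n (∣-trans p∣d d∣n)
    shifted : ∀ {n} → p ∤ n → 1 ℕ.≤ n →
      divisorSum (λ d → β (p ^ suc k ℕ.* d)) n ≡ h (p ^ suc k ℕ.* n) - h (p ^ k ℕ.* n)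
    shifted {n} p∤n 1≤n = begin
      divisorSum (λ d → β (p ^ suc k ℕ.* d)) n
        ≡⟨ solve 2 (λ a x → x := (a :+ x) :- a) refl (divisorSum β (p ^ k ℕ.* n)) _ ⟩
      (divisorSum β (p ^ k ℕ.* n) + divisorSum (λ d → β (p ^ suc k ℕ.* d)) n) - divisorSum β (p ^ k ℕ.* n)
        ≡⟨ cong₂ _-_ (sym (divisorSum-p^[1+k]* pp p∤n 1≤n k β)) (sym (isβ _ (1≤pʲ* k))) ⟩
      divisorSum β (p ^ suc k ℕ.* n) - h (p ^ k ℕ.* n)
        ≡⟨ cong (_- h (p ^ k ℕ.* n)) (sym (isβ _ (1≤pʲ* (suc k)))) ⟩
      h (p ^ suc k ℕ.* n) - h (p ^ k ℕ.* n) ∎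
      where
      open ≡-Reasoning
      1≤pʲ* : ∀ j → 1 ℕ.≤ p ^ j ℕ.* n
      1≤pʲ* j = ℕP.*-mono-≤ (ℕP.m^n>0 p {{prime⇒nonZero pp}} j) 1≤n
    sums : ∀ n → 1 ℕ.≤ n → p ∤ n → divisorSum g n ≡ 0ℚ
    sums n 1≤n p∤n = begin
      divisorSum g n
        ≡⟨ sumℚ-map-linear (λ d → β (p ^ suc k ℕ.* d)) β c (divisors n) ⟩
      divisorSum (λ d → β (p ^ suc k ℕ.* d)) n - c * divisorSum β n
        ≡⟨ cong₂ (λ x y → x - c * y) (shifted p∤n 1≤n) (sym (isβ n 1≤n)) ⟩
      (h (p ^ suc k ℕ.* n) - h (p ^ k ℕ.* n)) - c * h n
        ≡⟨ cong₂ (λ x y → (x - y) - c * h n) (h-p^k* pp p∤n 1≤n (suc k)) (h-p^k* pp p∤n 1≤n k) ⟩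
      (hLocal (suc k) r * h n - hLocal k r * h n) - c * h n
        ≡⟨ solve 3 (λ a b x → (a :* x :- b :* x) :- (a :- b) :* x := con 0ℚ) refl (hLocal (suc k) r) (hLocal k r) (h n) ⟩
      0ℚ ∎
      where
      open ≡-Reasoning
      r = eulerFactor p

  β-p^[3+i]*≡0 : ∀ {β} → IsBeta β → ∀ {p m j} → Prime p → p ∤ m → 1 ℕ.≤ m → 3 ℕ.≤ j →
    β (p ^ j ℕ.* m) ≡ 0ℚ
  β-p^[3+i]*≡0 {β} isβ {m = m} pp p∤m 1≤m (s≤s (s≤s (s≤s {n = i} _))) =
    trans (β-p^[1+k]* isβ pp p∤m 1≤m (suc (suc i))) (ℚP.*-zeroˡ (β m))

  k³∣⇒β≡0 : ∀ {β} → IsBeta β → ∀ {k t} → 1 ℕ.≤ t → 2 ℕ.≤ k → k ℕ.* k ℕ.* k ∣ t → β t ≡ 0ℚ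
  k³∣⇒β≡0 isβ {k} 1≤t 2≤k k³∣t
    with q , qq , q∣k ← ∃prime∣ 2≤k
    with j , m , refl , q∤m ← valuation qq 1≤t =
    β-p^[3+i]*≡0 isβ qq q∤m (∣⇒1≤ 1≤t (n∣m*n (q ^ j))) (^∣^*⇒≤ qq q∤m 3 j q³∣t)
    where
    cube : q ℕ.* q ℕ.* q ≡ q ^ 3
    cube = trans (ℕP.*-assoc q q q) (cong (λ x → q ℕ.* (q ℕ.* x)) (sym (ℕP.*-identityʳ q)))
    q³∣t : q ^ 3 ∣ q ^ j ℕ.* m
    q³∣t = subst (_∣ q ^ j ℕ.* m) cube (∣-trans (*-pres-∣ (*-pres-∣ q∣k q∣k) q∣k) k³∣t)

  β≢0⇒cubeFree : ∀ {β} → IsBeta β → ∀ {t} → 1 ℕ.≤ t → β t ≢ 0ℚ → CubeFree t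
  β≢0⇒cubeFree isβ 1≤t βt≢0 = cubeFree⇐ 1≤t (λ 2≤k k³∣t → βt≢0 (k³∣⇒β≡0 isβ 1≤t 2≤k k³∣t))

  ∣β∣-Formula : (ℕ → ℚ) → ℕ → ℕ → Set
  ∣β∣-Formula β a b = ∣ β (a ℕ.* (b ℕ.* b)) ∣ * ι (a ℕ.* a) ≡ ι (numDivisors a) * h (a ℕ.* b)

  ∣β∣-Formula-1 : ∀ {β} → IsBeta β → ∣β∣-Formula β 1 1
  -- Everything but β 1 computes to 1ℚ.
  ∣β∣-Formula-1 {β} isβ rewrite sym (trans (isβ 1 (s≤s z≤n)) (ℚP.+-identityʳ (β 1))) = refl

  ∣β∣-Formula-p*ˡ : ∀ {β} → IsBeta β → ∀ {p a b} → Prime p → SquareFree (p ℕ.* a) → SquareFree b →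
    Coprime (p ℕ.* a) b → ∣β∣-Formula β a b → ∣β∣-Formula β (p ℕ.* a) b
  ∣β∣-Formula-p*ˡ {β} isβ {p} {a} {b} pp sf[pa] sfb cop formula = begin
    ∣ β (p ℕ.* a ℕ.* (b ℕ.* b)) ∣ * ι (p ℕ.* a ℕ.* (p ℕ.* a))
      ≡⟨ cong₂ (λ x y → ∣ x ∣ * y) β[pm] (trans (cong ι (square p a)) (ι-* (p ℕ.* p) (a ℕ.* a))) ⟩
    ∣ (r - 1ℚ) * β m ∣ * (ι (p ℕ.* p) * ι (a ℕ.* a))
      ≡⟨ cong (_* (ι (p ℕ.* p) * ι (a ℕ.* a))) ∣[r-1]*βm∣ ⟩
    (r - 1ℚ) * ∣ β m ∣ * (ι (p ℕ.* p) * ι (a ℕ.* a))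
      ≡⟨ solve 4 (λ c B P A → c :* B :* (P :* A) := (c :* P) :* (B :* A))
               refl (r - 1ℚ) ∣ β m ∣ (ι (p ℕ.* p)) (ι (a ℕ.* a)) ⟩
    (r - 1ℚ) * ι (p ℕ.* p) * (∣ β m ∣ * ι (a ℕ.* a))
      ≡⟨ cong₂ _*_ ([eulerFactor-1]*p² 2≤p) formula ⟩
    ι 2 * r * (ι (numDivisors a) * h (a ℕ.* b))
      ≡⟨ solve 4 (λ t r d H → t :* r :* (d :* H) := t :* d :* (r :* H)) refl (ι 2) r (ι (numDivisors a)) (h (a ℕ.* b)) ⟩
    ι 2 * ι (numDivisors a) * (r * h (a ℕ.* b))
      ≡⟨ cong₂ _*_ (trans (sym (ι-* 2 (numDivisors a))) (cong ι (sym (numDivisors-p* pp p∤a 1≤a))))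
                   (trans (sym (h-p* pp p∤ab (ℕP.*-mono-≤ 1≤a 1≤b))) (cong h (sym (ℕP.*-assoc p a b)))) ⟩
    ι (numDivisors (p ℕ.* a)) * h (p ℕ.* a ℕ.* b) ∎
    where
    open ≡-Reasoning
    r = eulerFactor p
    2≤p = prime⇒2≤ pp
    m = a ℕ.* (b ℕ.* b)
    1≤a : 1 ℕ.≤ a
    1≤a = squareFree⇒1≤ (squareFree-∣ sf[pa] (n∣m*n p))
    1≤b : 1 ℕ.≤ b
    1≤b = squareFree⇒1≤ sfb
    p∤a : p ∤ a
    p∤a p∣a = squareFree⇒ sf[pa] 2≤p (*-monoʳ-∣ p p∣a)
    p∤b : p ∤ b
    p∤b = coprime∧prime∣⇒∤ cop pp (m∣m*n a)
    p∤ab = ∤∧∤⇒∤* pp p∤a p∤b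
    p∤m = ∤∧∤⇒∤* pp p∤a (∤∧∤⇒∤* pp p∤b p∤b)
    ∣[r-1]*βm∣ : ∣ (r - 1ℚ) * β m ∣ ≡ (r - 1ℚ) * ∣ β m ∣
    ∣[r-1]*βm∣ = trans (ℚP.∣p*q∣≡∣p∣*∣q∣ (r - 1ℚ) (β m))
                       (cong (_* ∣ β m ∣) (ℚP.0≤p⇒∣p∣≡p (0≤eulerFactor-1 2≤p)))
    β[pm] : β (p ℕ.* a ℕ.* (b ℕ.* b)) ≡ (r - 1ℚ) * β m
    β[pm] = trans (cong β (reassoc p a b)) (β-p^[1+k]* isβ pp p∤m (ℕP.*-mono-≤ 1≤a (ℕP.*-mono-≤ 1≤b 1≤b)) 0)
      where
      reassoc : ∀ p a b → p ℕ.* a ℕ.* (b ℕ.* b) ≡ p ℕ.* 1 ℕ.* (a ℕ.* (b ℕ.* b))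
      reassoc = solve-∀
    square : ∀ p a → p ℕ.* a ℕ.* (p ℕ.* a) ≡ p ℕ.* p ℕ.* (a ℕ.* a)
    square = solve-∀

  ∣β∣-Formula-p*ʳ : ∀ {β} → IsBeta β → ∀ {p a b} → Prime p → SquareFree a → SquareFree (p ℕ.* b) →
    Coprime a (p ℕ.* b) → ∣β∣-Formula β a b → ∣β∣-Formula β a (p ℕ.* b)
  ∣β∣-Formula-p*ʳ {β} isβ {p} {a} {b} pp sfa sf[pb] cop formula = begin
    ∣ β (a ℕ.* (p ℕ.* b ℕ.* (p ℕ.* b))) ∣ * ι (a ℕ.* a)
      ≡⟨ cong (λ x → ∣ x ∣ * ι (a ℕ.* a)) β[p²m] ⟩
    ∣ (0ℚ - r) * β m ∣ * ι (a ℕ.* a)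
      ≡⟨ cong (_* ι (a ℕ.* a)) (trans (ℚP.∣p*q∣≡∣p∣*∣q∣ (0ℚ - r) (β m)) (cong (_* ∣ β m ∣) ∣0-r∣≡r)) ⟩
    r * ∣ β m ∣ * ι (a ℕ.* a)
      ≡⟨ ℚP.*-assoc r ∣ β m ∣ (ι (a ℕ.* a)) ⟩
    r * (∣ β m ∣ * ι (a ℕ.* a))
      ≡⟨ cong (r *_) formula ⟩
    r * (ι (numDivisors a) * h (a ℕ.* b))
      ≡⟨ solve 3 (λ r d H → r :* (d :* H) := d :* (r :* H)) refl r (ι (numDivisors a)) (h (a ℕ.* b)) ⟩
    ι (numDivisors a) * (r * h (a ℕ.* b))
      ≡⟨ cong (ι (numDivisors a) *_) (trans (sym (h-p* pp p∤ab (ℕP.*-mono-≤ 1≤a 1≤b))) (cong h (swap p a b))) ⟩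
    ι (numDivisors a) * h (a ℕ.* (p ℕ.* b)) ∎
    where
    open ≡-Reasoning
    r = eulerFactor p
    m = a ℕ.* (b ℕ.* b)
    1≤a : 1 ℕ.≤ a
    1≤a = squareFree⇒1≤ sfa
    1≤b : 1 ℕ.≤ b
    1≤b = squareFree⇒1≤ (squareFree-∣ sf[pb] (n∣m*n p))
    p∤a : p ∤ a
    p∤a p∣a = coprime∧prime∣⇒∤ cop pp p∣a (m∣m*n b)
    p∤b : p ∤ b
    p∤b p∣b = squareFree⇒ sf[pb] (prime⇒2≤ pp) (*-monoʳ-∣ p p∣b)
    p∤ab = ∤∧∤⇒∤* pp p∤a p∤b
    p∤m = ∤∧∤⇒∤* pp p∤a (∤∧∤⇒∤* pp p∤b p∤b)
    ∣0-r∣≡r : ∣ 0ℚ - r ∣ ≡ r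
    ∣0-r∣≡r = trans (cong ∣_∣ (ℚP.+-identityˡ (ℚ.- r)))
      (trans (ℚP.∣-p∣≡∣p∣ r) (ℚP.0≤p⇒∣p∣≡p (0≤eulerFactor (prime⇒2≤ pp))))
    β[p²m] : β (a ℕ.* (p ℕ.* b ℕ.* (p ℕ.* b))) ≡ (0ℚ - r) * β m
    β[p²m] = trans (cong β (reassoc p a b)) (β-p^[1+k]* isβ pp p∤m (ℕP.*-mono-≤ 1≤a (ℕP.*-mono-≤ 1≤b 1≤b)) 1)
      where
      reassoc : ∀ p a b → a ℕ.* (p ℕ.* b ℕ.* (p ℕ.* b)) ≡ p ℕ.* (p ℕ.* 1) ℕ.* (a ℕ.* (b ℕ.* b))
      reassoc = solve-∀
    swap : ∀ p a b → p ℕ.* (a ℕ.* b) ≡ a ℕ.* (p ℕ.* b)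
    swap = solve-∀

  ∣β∣-formula : ∀ {β} → IsBeta β → ∀ {a b} → SquareFree a → SquareFree b → Coprime a b → ∣β∣-Formula β a b
  ∣β∣-formula {β} isβ {a} {b} sfa sfb cop = go sfa sfb cop (<-wellFounded (a ℕ.* b))
    where
    go : ∀ {a b} → SquareFree a → SquareFree b → Coprime a b → Acc ℕ._<_ (a ℕ.* b) → ∣β∣-Formula β a b
    go {a} {b} sfa sfb cop (acc rec) with a ℕ.* b ℕ.≟ 1
    ... | yes ab≡1 rewrite ℕP.m*n≡1⇒m≡1 a b ab≡1 | ℕP.m*n≡1⇒n≡1 a b ab≡1 = ∣β∣-Formula-1 isβ
    ... | no ab≢1
      with p , pp , p∣ab ← ∃prime∣ (ℕP.≤∧≢⇒< (ℕP.*-mono-≤ (squareFree⇒1≤ {a} sfa) (squareFree⇒1≤ {b} sfb))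
                                             (ab≢1 ∘ sym))
      with euclidsLemma a b pp p∣ab
    ...   | inj₁ p∣a with a′ , refl ← ∣⇒∃≡* p∣a =
      ∣β∣-Formula-p*ˡ isβ pp sfa sfb cop
        (go (squareFree-∣ sfa (n∣m*n p)) sfb (coprime-∣ (n∣m*n p) ∣-refl cop)
            (rec (subst (a′ ℕ.* b ℕ.<_) (sym (ℕP.*-assoc p a′ b)) (m<p*m pp 1≤ab))))
      where
      1≤ab : 1 ℕ.≤ a′ ℕ.* b
      1≤ab = ℕP.*-mono-≤ (squareFree⇒1≤ {a′} (squareFree-∣ sfa (n∣m*n p))) (squareFree⇒1≤ {b} sfb)
    ...   | inj₂ p∣b with b′ , refl ← ∣⇒∃≡* p∣b =
      ∣β∣-Formula-p*ʳ isβ pp sfa sfb cop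
        (go sfa (squareFree-∣ sfb (n∣m*n p)) (coprime-∣ ∣-refl (n∣m*n p) cop)
            (rec (subst (a ℕ.* b′ ℕ.<_) (swap p a b′) (m<p*m pp 1≤ab))))
      where
      1≤ab : 1 ℕ.≤ a ℕ.* b′
      1≤ab = ℕP.*-mono-≤ (squareFree⇒1≤ {a} sfa) (squareFree⇒1≤ (squareFree-∣ sfb (n∣m*n p)))
      swap : ∀ p a b → p ℕ.* (a ℕ.* b) ≡ a ℕ.* (p ℕ.* b)
      swap = solve-∀

  h≤6 : ∀ n → h n ≤ ι 6
  h≤6 n = μ²*Π≤6 (isSquareFree n)
    where
    Π = prodℚ (map eulerFactor (primeDivisors n))
    μ²*Π≤6 : ∀ b → (if b then 1ℚ else 0ℚ) * Π ≤ ι 6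
    μ²*Π≤6 true  = subst (_≤ ι 6) (sym (ℚP.*-identityˡ Π))
                     (prodℚ-eulerFactor≤6 (primeDivisors-increasing n) (primeDivisors-2≤ n))
    μ²*Π≤6 false = subst (_≤ ι 6) (sym (ℚP.*-zeroˡ Π)) (0≤ι 6)

  ∣β[ab²]∣≤6*d[a]/a² : ∀ {β} → IsBeta β → ∀ {a b} → SquareFree a → SquareFree b → Coprime a b →
    ∣ β (a ℕ.* (b ℕ.* b)) ∣ ≤ ι 6 * (ι (numDivisors a) * recip (ι (a ℕ.* a)))
  ∣β[ab²]∣≤6*d[a]/a² {β} isβ {a} {b} sfa sfb cop = begin
    B                                   ≡⟨ ℚP.*-identityʳ B ⟨
    B * 1ℚ                              ≡⟨ cong (B *_) (*-recip A (ι≢0 1≤a²)) ⟨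
    B * (A * recip A)                   ≡⟨ ℚP.*-assoc B A (recip A) ⟨
    B * A * recip A                     ≡⟨ cong (_* recip A) (∣β∣-formula isβ sfa sfb cop) ⟩
    ι d * h (a ℕ.* b) * recip A         ≤⟨ 0≤⇒*-monoʳ-≤ 0≤1/A (0≤⇒*-monoˡ-≤ (0≤ι d) (h≤6 (a ℕ.* b))) ⟩
    ι d * ι 6 * recip A                 ≡⟨ solve 3 (λ d s x → d :* s :* x := s :* (d :* x)) refl (ι d) (ι 6) (recip A) ⟩
    ι 6 * (ι d * recip A)               ∎
    where
    open ℚP.≤-Reasoning
    B = ∣ β (a ℕ.* (b ℕ.* b)) ∣
    A = ι (a ℕ.* a)
    d = numDivisors a
    1≤a² : 1 ℕ.≤ a ℕ.* a
    1≤a² = ℕP.*-mono-≤ (squareFree⇒1≤ {a} sfa) (squareFree⇒1≤ {a} sfa)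
    0≤1/A = 0≤recip (0<ι 1≤a²)

open import Data.Nat using (ℕ; _*_; z≤n; s≤s)
open import Data.Nat.Coprimality using (Coprime)
open import Data.Product using (_×_; ∃-syntax; _,_)
open import Data.Rational using (ℚ; 0ℚ; _<_; _≤_; ∣_∣)
open import Relation.Binary.PropositionalEquality using (_≡_; _≢_; refl)
open RationalArithmetic using (0<ι)
open Beta using (β≢0⇒cubeFree; ∣β[ab²]∣≤6*d[a]/a²)

lemma4p2 : (β : ℕ → ℚ) → IsBeta β →
    ((t : ℕ) → 1 Data.Nat.≤ t → β t ≢ 0ℚ → CubeFree t)
    × (∃[ c ] (0ℚ < c × ((t a b : ℕ) → CubeFree t → SquareFree a → SquareFree b → Coprime a b → t ≡ a * (b * b) →
        ∣ β t ∣ ≤ c Data.Rational.* (ι (numDivisors a) Data.Rational.* recip (ι (a * a))))))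
lemma4p2 β isβ =
  (λ _ 1≤t βt≢0 → β≢0⇒cubeFree isβ 1≤t βt≢0) ,
  ι 6 , 0<ι {6} (s≤s z≤n) ,
  λ { _ a b _ sfa sfb cop refl → ∣β[ab²]∣≤6*d[a]/a² isβ sfa sfb cop }
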